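{- Let $\varphi=\exists x_1\cdots\exists x_n\,\phi(x_1,\dots,x_n)$ be an elementary first-order existential sentence. Then: (1) if $\phi$ is additive and $\mathcal{U},\mathcal{V}$ are $\varphi$-ultrafilters, then $\mathcal{U}\oplus\mathcal{V}$ is a $\varphi$-ultrafilter; (2) if $\phi$ is multiplicative and $\mathcal{U},\mathcal{V}$ are $\varphi$-ultrafilters, then $\mathcal{U}\odot\mathcal{V}$ is a $\varphi$-ultrafilter; (3) if $\phi$ is additively invariant, $\mathcal{U}$ is a $\varphi$-ultrafilter and $\mathcal{V}$ is any ultrafilter on $\mathbb{N}$, then $\mathcal{U}\oplus\mathcal{V}$ and $\mathcal{V}\oplus\mathcal{U}$ are $\varphi$-ultrafilters; (4) if $\phi$ is multiplicatively invariant, $\mathcal{U}$ is a $\varphi$-ultrafilter and $\mathcal{V}$ is any ultrafilter on $\mathbb{N}$ other than the principal ultrafilter $\mathfrak{U}_0$ at $0$, then $\mathcal{U}\odot\mathcal{V}$ and $\mathcal{V}\odot\mathcal{U}$ are $\varphi$-ultrafilters.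
   Context: A formula is elementary if it is a bounded-quantifier formula whose only parameters are elements of $\mathbb{N}^k$, subsets of $\mathbb{N}^k$, functions $\mathbb{N}^k\to\mathbb{N}^h$, or relations on $\mathbb{N}^k$. $\phi$ is additive if $\phi(a_1,\dots,a_n)$ and $\phi(b_1,\dots,b_n)$ imply $\phi(a_1+b_1,\dots,a_n+b_n)$ for all naturals; multiplicative similarly with products; additively invariant if for all $a_1,\dots,a_n,b\in\mathbb{N}$, $\phi(a_1,\dots,a_n)\iff\phi(a_1+b,\dots,a_n+b)$; multiplicatively invariant if for all $a_i$ and all $b\neq0$, $\phi(a_1,\dots,a_n)\iff\phi(a_1b,\dots,a_nb)$. A set $A\subseteq\mathbb{N}$ satisfies $\varphi$ if there are $a_1,\dots,a_n\in A$ with $\phi(a_1,\dots,a_n)$; an ultrafilter $\mathcal{U}$ on $\mathbb{N}$ is a $\varphi$-ultrafilter if every $A\in\mathcal{U}$ satisfies $\varphi$. For ultrafilters on $\mathbb{N}$: $A\in\mathcal{U}\oplus\mathcal{V}$ iff $\{n:\{m:n+m\in A\}\in\mathcal{V}\}\in\mathcal{U}$, and $A\in\mathcal{U}\odot\mathcal{V}$ iff $\{n:\{m:nm\in A\}\in\mathcal{V}\}\in\mathcal{U}$. -}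

module Defs where

open import Data.Nat using (ℕ; zero; suc; _+_; _*_)
open import Data.Fin using (Fin)
open import Data.Vec.Functional using (Vector; _∷_)
open import Data.Product using (Σ; ∃; _×_; _,_; proj₁; proj₂)
open import Data.Sum using (_⊎_; inj₁; inj₂)
open import Data.Empty using (⊥; ⊥-elim)
open import Data.Unit using (⊤)
open import Relation.Nullary using (¬_)
open import Relation.Binary.PropositionalEquality using (_≡_; _≢_)
open import Function.Bundles using (_⇔_)

-- Elementary (bounded-quantifier) formulas with parameters.
-- Parameters: elements of ℕᵏ (tuples of constants), subsets of ℕᵏ,
-- functions ℕᵏ → ℕʰ, relations on ℕᵏ (a relation on ℕᵏ is a subset of
-- ℕ^{2k}, so it is covered by the subset parameter 'mem').

data Term (m : ℕ) : Set₁ where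
  var   : Fin m → Term m
  const : ℕ → Term m
  app   : (k h : ℕ) → (Vector ℕ k → Vector ℕ h) → Fin h → (Fin k → Term m) → Term m

data Formula (m : ℕ) : Set₁ where
  _≐_  : Term m → Term m → Formula m
  mem  : (k : ℕ) → (Vector ℕ k → Set) → (Fin k → Term m) → Formula m
  rel  : (k : ℕ) → (Vector ℕ k → Vector ℕ k → Set) → (Fin k → Term m) → (Fin k → Term m) → Formula m
  ⊤ᶠ ⊥ᶠ : Formula m
  ¬ᶠ_  : Formula m → Formula m
  _∧ᶠ_ _∨ᶠ_ _⇒ᶠ_ : Formula m → Formula m → Formula m
  -- ∀ x ≤ t. ψ  and  ∃ x ≤ t. ψ   (bound variable is index 0 of ψ)
  ∀≤ ∃≤ : Term m → Formula (suc m) → Formula m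

infix 4 _≤ℕ_
data _≤ℕ_ : ℕ → ℕ → Set where
  z≤ : ∀ {n} → zero ≤ℕ n
  s≤ : ∀ {m n} → m ≤ℕ n → suc m ≤ℕ suc n

evalT : ∀ {m} → Term m → Vector ℕ m → ℕ
evalTs : ∀ {m k} → (Fin k → Term m) → Vector ℕ m → Vector ℕ k
evalT (var i) ρ = ρ i
evalT (const c) ρ = c
evalT (app k h f j ts) ρ = f (evalTs ts ρ) j
evalTs ts ρ i = evalT (ts i) ρ

⟦_⟧ : ∀ {m} → Formula m → Vector ℕ m → Set
⟦ s ≐ t ⟧ ρ = evalT s ρ ≡ evalT t ρ
⟦ mem k S ts ⟧ ρ = S (evalTs ts ρ)
⟦ rel k R ss ts ⟧ ρ = R (evalTs ss ρ) (evalTs ts ρ)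
⟦ ⊤ᶠ ⟧ ρ = ⊤
⟦ ⊥ᶠ ⟧ ρ = ⊥
⟦ ¬ᶠ ψ ⟧ ρ = ¬ ⟦ ψ ⟧ ρ
⟦ ψ ∧ᶠ χ ⟧ ρ = ⟦ ψ ⟧ ρ × ⟦ χ ⟧ ρ
⟦ ψ ∨ᶠ χ ⟧ ρ = ⟦ ψ ⟧ ρ ⊎ ⟦ χ ⟧ ρ
⟦ ψ ⇒ᶠ χ ⟧ ρ = ⟦ ψ ⟧ ρ → ⟦ χ ⟧ ρ
⟦ ∀≤ t ψ ⟧ ρ = ∀ x → x ≤ℕ evalT t ρ → ⟦ ψ ⟧ (x ∷ ρ)
⟦ ∃≤ t ψ ⟧ ρ = Σ ℕ λ x → x ≤ℕ evalT t ρ × ⟦ ψ ⟧ (x ∷ ρ)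

Additive : ∀ {n} → Formula n → Set
Additive φ = ∀ a b → ⟦ φ ⟧ a → ⟦ φ ⟧ b → ⟦ φ ⟧ (λ i → a i + b i)

Multiplicative : ∀ {n} → Formula n → Set
Multiplicative φ = ∀ a b → ⟦ φ ⟧ a → ⟦ φ ⟧ b → ⟦ φ ⟧ (λ i → a i * b i)

AdditivelyInvariant : ∀ {n} → Formula n → Set
AdditivelyInvariant φ = ∀ a (b : ℕ) → ⟦ φ ⟧ a ⇔ ⟦ φ ⟧ (λ i → a i + b)

MultiplicativelyInvariant : ∀ {n} → Formula n → Set
MultiplicativelyInvariant φ = ∀ a (b : ℕ) → b ≢ 0 → ⟦ φ ⟧ a ⇔ ⟦ φ ⟧ (λ i → a i * b)

record Ultrafilter : Set₁ where
  field
    _∈U : (ℕ → Set) → Set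
    mono      : ∀ {A B} → (∀ n → A n → B n) → _∈U A → _∈U B
    inter     : ∀ {A B} → _∈U A → _∈U B → _∈U (λ n → A n × B n)
    inhabited : ∀ {A} → _∈U A → ∃ A
    ultra     : ∀ A → _∈U A ⊎ _∈U (λ n → ¬ A n)
open Ultrafilter public

Satisfies : ∀ {n} → Formula n → (ℕ → Set) → Set
Satisfies {n} φ A = Σ (Vector ℕ n) λ a → (∀ i → A (a i)) × ⟦ φ ⟧ a

IsφUltrafilter : ∀ {n} → Formula n → Ultrafilter → Set₁
IsφUltrafilter φ U = ∀ A → _∈U U A → Satisfies φ A

IsPrincipalAt0 : Ultrafilter → Set₁
IsPrincipalAt0 V = ∀ A → (_∈U V A → A 0) × (A 0 → _∈U V A)

private
  compl-from : (V : Ultrafilter) → ∀ C → ¬ _∈U V C → _∈U V (λ m → ¬ C m)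
  compl-from V C h with ultra V C
  ... | inj₁ p = ⊥-elim (h p)
  ... | inj₂ q = q

module _ (op : ℕ → ℕ → ℕ) (U V : Ultrafilter) where
  private
    memOp : (ℕ → Set) → Set
    memOp A = _∈U U (λ x → _∈U V (λ y → A (op x y)))

    monoOp : ∀ {A B} → (∀ n → A n → B n) → memOp A → memOp B
    monoOp {A} {B} h = mono U (λ x → mono V {λ y → A (op x y)} {λ y → B (op x y)} (λ y → h (op x y)))

    interOp : ∀ {A B} → memOp A → memOp B → memOp (λ n → A n × B n)
    interOp {A} {B} p q = mono U (λ x r → inter V {λ y → A (op x y)} {λ y → B (op x y)} (proj₁ r) (proj₂ r)) (inter U p q)

    inhOp : ∀ {A} → memOp A → ∃ A
    inhOp p with inhabited U p
    ... | x , px with inhabited V px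
    ... | y , py = op x y , py

    ultraOp : ∀ A → memOp A ⊎ memOp (λ n → ¬ A n)
    ultraOp A with ultra U (λ x → _∈U V (λ y → A (op x y)))
    ... | inj₁ p = inj₁ p
    ... | inj₂ q = inj₂ (mono U (λ x → compl-from V (λ y → A (op x y))) q)

  opUltra : Ultrafilter
  opUltra = record
    { _∈U = memOp ; mono = λ {A} {B} → monoOp {A} {B} ; inter = λ {A} {B} → interOp {A} {B}
    ; inhabited = λ {A} → inhOp {A} ; ultra = ultraOp }

_⊕_ : Ultrafilter → Ultrafilter → Ultrafilter
U ⊕ V = opUltra _+_ U V

_⊙_ : Ultrafilter → Ultrafilter → Ultrafilter
U ⊙ V = opUltra _*_ U V

-- A ∈ U ∘ V (∘ = + or ·) says that X = {x : {y : x ∘ y ∈ A} ∈ V} lies in U.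
-- For a φ-witness a₁,…,aₙ ∈ X the finite intersection ⋂ᵢ {y : aᵢ ∘ y ∈ A}
-- lies in V, and its elements y give candidate witnesses aᵢ ∘ y: taking a
-- φ-witness y₁,…,yₙ there and using closure under ∘ gives (1)–(2), taking a
-- single y and using invariance gives (3)–(4). For V ∘ U one picks x first
-- and a φ-witness of {y : x ∘ y ∈ A} ∈ U, then commutes. In (4) the shift
-- must be nonzero; an ultrafilter other than 𝔘₀ contains the nonzero numbers.
module Submission where

open import Defs
open import Algebra.Definitions using (Commutative)
open import Data.Nat using (ℕ; zero; suc; _+_; _*_; _≟_)
open import Data.Nat.Properties using (+-comm; *-comm)
open import Data.Fin using (Fin)
import Data.Fin as Fin
open import Data.Product using (_×_; _,_; proj₂)
open import Data.Sum using (inj₁; inj₂)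
open import Data.Empty using (⊥-elim)
open import Data.Unit using (⊤; tt)
open import Relation.Nullary using (¬_; contradiction)
open import Relation.Nullary.Decidable using (decidable-stable)
open import Relation.Binary.PropositionalEquality using (_≡_; _≢_; subst)
open import Function.Bundles using (Equivalence)

infix 4 _∈_
_∈_ : (ℕ → Set) → Ultrafilter → Set
A ∈ V = _∈U V A

module _ (V : Ultrafilter) where

  whole∈ : (λ _ → ⊤) ∈ V
  whole∈ with ultra V (λ _ → ⊤)
  ... | inj₁ p = p
  ... | inj₂ q = ⊥-elim (proj₂ (inhabited V q) tt)

  ⋂∈ : ∀ {k} (P : Fin k → ℕ → Set) → (∀ i → P i ∈ V) → (λ y → ∀ i → P i y) ∈ V
  ⋂∈ {zero}  P h = mono V (λ _ _ ()) whole∈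
  ⋂∈ {suc k} P h =
    mono V (λ { y (p₀ , ps) Fin.zero → p₀ ; y (p₀ , ps) (Fin.suc i) → ps i })
      (inter V (h Fin.zero) (⋂∈ (λ i → P (Fin.suc i)) (λ i → h (Fin.suc i))))

  private
    Zero : ℕ → Set
    Zero y = ¬ y ≢ 0

    ∈⇒holds-at-0 : ∀ {B} → Zero ∈ V → B ∈ V → B 0
    ∈⇒holds-at-0 {B} Z∈V B∈V with inhabited V (inter V B∈V Z∈V)
    ... | y , By , y≡0 = subst B (decidable-stable (y ≟ 0) y≡0) By

  ¬principal⇒≢0∈ : ¬ IsPrincipalAt0 V → (λ y → y ≢ 0) ∈ V
  ¬principal⇒≢0∈ ¬principal with ultra V (λ y → y ≢ 0)
  ... | inj₁ ≢0∈V = ≢0∈V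
  ... | inj₂ Z∈V  = contradiction principal ¬principal
    where
    principal : IsPrincipalAt0 V
    principal B = ∈⇒holds-at-0 Z∈V , holds-at-0⇒∈
      where
      holds-at-0⇒∈ : B 0 → B ∈ V
      holds-at-0⇒∈ B0 with ultra V B
      ... | inj₁ B∈V  = B∈V
      ... | inj₂ ∁B∈V = ⊥-elim (∈⇒holds-at-0 Z∈V ∁B∈V B0)

module _ {n : ℕ} (φ : Formula n) (_∘_ : ℕ → ℕ → ℕ) where

  ClosedUnder : Set
  ClosedUnder = ∀ a b → ⟦ φ ⟧ a → ⟦ φ ⟧ b → ⟦ φ ⟧ (λ i → a i ∘ b i)

  StableUnderRightAction : (ℕ → Set) → Set
  StableUnderRightAction B = ∀ a y → B y → ⟦ φ ⟧ a → ⟦ φ ⟧ (λ i → a i ∘ y)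

  opUltra-closed : ClosedUnder → ∀ U V → IsφUltrafilter φ U → IsφUltrafilter φ V →
                   IsφUltrafilter φ (opUltra _∘_ U V)
  opUltra-closed closed U V φU φV A A∈U∘V with φU _ A∈U∘V
  ... | a , a∈ , φa with φV _ (⋂∈ V (λ i y → A (a i ∘ y)) a∈)
  ... | b , b∈ , φb = (λ i → a i ∘ b i) , (λ i → b∈ i i) , closed a b φa φb

  opUltra-stableˡ : ∀ {B} U V → StableUnderRightAction B → B ∈ V →
                    IsφUltrafilter φ U → IsφUltrafilter φ (opUltra _∘_ U V)
  opUltra-stableˡ U V stable B∈V φU A A∈U∘V with φU _ A∈U∘V
  ... | a , a∈ , φa with inhabited V (inter V (⋂∈ V (λ i y → A (a i ∘ y)) a∈) B∈V)
  ... | y , ay∈A , By = (λ i → a i ∘ y) , ay∈A , stable a y By φa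

  opUltra-stableʳ : ∀ {B} U V → Commutative _≡_ _∘_ → StableUnderRightAction B → B ∈ V →
                    IsφUltrafilter φ U → IsφUltrafilter φ (opUltra _∘_ V U)
  opUltra-stableʳ U V comm stable B∈V φU A A∈V∘U with inhabited V (inter V A∈V∘U B∈V)
  ... | x , xa∈A , Bx with φU _ xa∈A
  ... | a , a∈ , φa = (λ i → a i ∘ x) , (λ i → subst A (comm x (a i)) (a∈ i)) , stable a x Bx φa

theorem3p3p5 : {n : ℕ} (φ : Formula n) →
    ((Additive φ → ∀ U V → IsφUltrafilter φ U → IsφUltrafilter φ V →
    IsφUltrafilter φ (U ⊕ V))
    × (Multiplicative φ → ∀ U V → IsφUltrafilter φ U → IsφUltrafilter φ V →
    IsφUltrafilter φ (U ⊙ V)))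
    × ((AdditivelyInvariant φ → ∀ U V → IsφUltrafilter φ U →
    IsφUltrafilter φ (U ⊕ V) × IsφUltrafilter φ (V ⊕ U))
    × (MultiplicativelyInvariant φ → ∀ U V → IsφUltrafilter φ U →
    ¬ IsPrincipalAt0 V →
    IsφUltrafilter φ (U ⊙ V) × IsφUltrafilter φ (V ⊙ U)))
theorem3p3p5 φ =
  (opUltra-closed φ _+_ , opUltra-closed φ _*_) , (additivelyInvariant , multiplicativelyInvariant)
  where
  additivelyInvariant : AdditivelyInvariant φ → ∀ U V → IsφUltrafilter φ U →
                        IsφUltrafilter φ (U ⊕ V) × IsφUltrafilter φ (V ⊕ U)
  additivelyInvariant inv U V φU =
      opUltra-stableˡ φ _+_ U V stable (whole∈ V) φU
    , opUltra-stableʳ φ _+_ U V +-comm stable (whole∈ V) φU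
    where
    stable : StableUnderRightAction φ _+_ (λ _ → ⊤)
    stable a y _ = Equivalence.to (inv a y)

  multiplicativelyInvariant : MultiplicativelyInvariant φ → ∀ U V → IsφUltrafilter φ U →
                              ¬ IsPrincipalAt0 V → IsφUltrafilter φ (U ⊙ V) × IsφUltrafilter φ (V ⊙ U)
  multiplicativelyInvariant inv U V φU ¬principal =
      opUltra-stableˡ φ _*_ U V stable (¬principal⇒≢0∈ V ¬principal) φU
    , opUltra-stableʳ φ _*_ U V *-comm stable (¬principal⇒≢0∈ V ¬principal) φU
    where
    stable : StableUnderRightAction φ _*_ (λ y → y ≢ 0)
    stable a y y≢0 = Equivalence.to (inv a y y≢0)
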